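{- Let $G=(V,E)$ be a multigraph, $T\subseteq V$ a set of terminals, $c$ a positive integer, $CC$ a $c$-cut containment set for $G$ with respect to $T$, and $F$ an unweighted spanning forest of $G\setminus CC$. Then for every integer $\gamma > c$ the multigraph $H=\mathsf{Sparsifier}_{c,\gamma}(G,T,CC,F)$ satisfies: (1) the cut-set of any $c$-cut of $H$ is the cut-set of a cut of $G$ of the same size; (2) if $G$ has a $c$-cut $C$ that partitions $T$ into two non-empty sets $T'$ and $T\setminus T'$, then $H$ has a cut $C'$ whose size is at most the size of $C$ and which partitions $T$ into $T'$ and $T\setminus T'$.
   Context: A multigraph $G=(V,E)$ has edge set consisting of triples $(u,v,\alpha)$ with $u,v\in V$ and $\alpha$ a positive integer (the multiplicity), with at most one triple per unordered pair $\{u,v\}$. For $E'\subseteq E$, $|E'|=\sum_{(u,v,\alpha)\in E'}\alpha$, $\mathsf{End}(E')$ is the set of endpoints of edges of $E'$, and $G\setminus E'=(V,E\setminus E')$. A cut is a bipartition of the vertex set into two non-empty sets; its cut-set is the set of edges with endpoints on different sides; its size is the sum of multiplicities of edges in the cut-set; it is a $c$-cut if its size is at most $c$. For $T\subseteq V$, a cut is a terminal cut if it partitions $T$ into two non-empty sets; a $(T',T\setminus T',c)$-cut is a $c$-cut partitioning $T$ into $T'$ and $T\setminus T'$, and a minimum such cut is one of smallest size among them. A set of edges $CC\subseteq E$ is a $c$-cut containment set with respect to $T$ if $CC$ is exactly the set of intercluster edges (edges with endpoints in different parts) of some partition of $V$, and for every bipartition $(T',T\setminus T')$ of $T$ such that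 $G$ has a $(T',T\setminus T',c)$-cut, there is a minimum $(T',T\setminus T',c)$-cut whose cut-set is contained in $CC$. For an unweighted forest $F$ and $K\subseteq V(F)$, $\mathsf{Contract}_K(F)$ is the forest obtained from $F$ by repeatedly deleting vertices not in $K$ of degree at most $1$ and shortcutting vertices $x\notin K$ of degree $2$ (replacing edges $u$–$x$, $x$–$w$ by a single edge $u$–$w$). For an integer $\gamma>c$, $\mathsf{Sparsifier}_{c,\gamma}(G,T,CC,F)$ is the multigraph whose vertex set is the vertex set of $\mathsf{Contract}_{T\cup\mathsf{End}(CC)}(F)$ and whose edges are the edges of $CC$ together with the edges of $\mathsf{Contract}_{T\cup\mathsf{End}(CC)}(F)$, where the edge between $x$ and $y$ has multiplicity $\alpha$ if $(x,y,\alpha)\in CC$ and multiplicity $\gamma$ otherwise. -}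

module Defs where

open import Data.Nat using (ℕ; zero; suc; _+_; _≤_; _<_; _<ᵇ_)
open import Data.Bool using (Bool; true; false; _∧_; _∨_; not; _xor_; if_then_else_)
open import Data.Fin using (Fin; toℕ) renaming (zero to fzero; suc to fsuc)
import Data.Fin as Fin
open import Data.List using (List; []; _∷_; length; _∷ʳ_)
open import Data.List.Relation.Unary.Linked using (Linked)
open import Data.List.Relation.Unary.Unique.Propositional using (Unique)
open import Data.Product using (Σ; ∃; _×_; _,_)
open import Data.Sum using (_⊎_)
open import Relation.Nullary using (¬_)
open import Relation.Nullary.Decidable using (⌊_⌋)
open import Relation.Binary.PropositionalEquality using (_≡_; _≢_)
open import Relation.Binary.Construct.Closure.ReflexiveTransitive using (Star)
open import Function using (_∘_; _⇔_)

sumFin : ∀ {n} → (Fin n → ℕ) → ℕ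
sumFin {zero}  f = 0
sumFin {suc n} f = f fzero + sumFin (f ∘ fsuc)

_==_ : ∀ {n} → Fin n → Fin n → Bool
u == v = ⌊ u Fin.≟ v ⌋

-- Multigraphs on vertex set V = Fin n.
-- A multigraph is given by a symmetric multiplicity function w;
-- (u , v , α) is an edge iff w u v ≡ α and 0 < α.

Weights : ℕ → Set
Weights n = Fin n → Fin n → ℕ

record Multigraph (n : ℕ) : Set where
  field
    w    : Weights n
    symm : ∀ u v → w u v ≡ w v u

EdgeSet : ℕ → Set
EdgeSet n = Fin n → Fin n → Bool

VSet : ℕ → Set
VSet n = Fin n → Bool

-- A bipartition of vertices is encoded by a side labelling S : Fin n → Bool.
-- S is a cut of the vertex set VS (both sides non-empty inside VS).
IsCutOn : ∀ {n} → VSet n → (Fin n → Bool) → Set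
IsCutOn VS S = (∃ λ u → VS u ≡ true × S u ≡ true) × (∃ λ v → VS v ≡ true × S v ≡ false)

IsCut : ∀ {n} → (Fin n → Bool) → Set
IsCut S = IsCutOn (λ _ → true) S

-- size of the cut S: sum of multiplicities over unordered pairs {u,v}
-- (counted once, via toℕ u < toℕ v) whose endpoints lie on different sides
cutSize : ∀ {n} → Weights n → (Fin n → Bool) → ℕ
cutSize w S = sumFin λ u → sumFin λ v →
  if (toℕ u <ᵇ toℕ v) ∧ (S u xor S v) then w u v else 0

InCutSet : ∀ {n} → Weights n → (Fin n → Bool) → Fin n → Fin n → Set
InCutSet w S u v = 0 < w u v × S u ≢ S v

PartitionsT : ∀ {n} → (Fin n → Bool) → VSet n → VSet n → Set
PartitionsT S T T' =
    (∀ t → T t ≡ true → S t ≡ T' t)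
  ⊎ (∀ t → T t ≡ true → S t ≡ not (T' t))

IsBipartitionOf : ∀ {n} → VSet n → VSet n → Set
IsBipartitionOf T T' =
    (∀ t → T' t ≡ true → T t ≡ true)
  × (∃ λ t → T' t ≡ true)
  × (∃ λ t → T t ≡ true × T' t ≡ false)

IsTCut : ∀ {n} → Weights n → VSet n → VSet n → ℕ → (Fin n → Bool) → Set
IsTCut w T T' c S = IsCut S × cutSize w S ≤ c × PartitionsT S T T'

IsMinTCut : ∀ {n} → Weights n → VSet n → VSet n → ℕ → (Fin n → Bool) → Set
IsMinTCut w T T' c S =
  IsTCut w T T' c S × (∀ S' → IsTCut w T T' c S' → cutSize w S ≤ cutSize w S')

-- CC is exactly the set of intercluster edges of a partition of V
-- (the partition is given by a cluster label p : Fin n → Fin n)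
IsInterclusterSet : ∀ {n} → Weights n → EdgeSet n → Set
IsInterclusterSet {n} w CC =
  ∃ λ (p : Fin n → Fin n) → ∀ u v → (CC u v ≡ true) ⇔ (0 < w u v × p u ≢ p v)

IsCutContainmentSet : ∀ {n} → Weights n → VSet n → ℕ → EdgeSet n → Set
IsCutContainmentSet w T c CC =
    IsInterclusterSet w CC
  × (∀ T' → IsBipartitionOf T T' →
       (∃ λ S → IsTCut w T T' c S) →
       ∃ λ S → IsMinTCut w T T' c S
             × (∀ u v → InCutSet w S u v → CC u v ≡ true))

removeEdges : ∀ {n} → Weights n → EdgeSet n → Weights n
removeEdges w E' u v = if E' u v then 0 else w u v

InEnd : ∀ {n} → EdgeSet n → Fin n → Set
InEnd CC x = ∃ λ y → CC x y ≡ true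

HasCycle : ∀ {n} → EdgeSet n → Set
HasCycle {n} A =
  Σ (Fin n) λ x → Σ (List (Fin n)) λ ys →
    2 ≤ length ys × Unique (x ∷ ys) ×
    Linked (λ a b → A a b ≡ true) ((x ∷ ys) ∷ʳ x)

IsForest : ∀ {n} → EdgeSet n → Set
IsForest A = (∀ u v → A u v ≡ A v u) × (∀ u → A u u ≡ false) × ¬ HasCycle A

ConnectedW : ∀ {n} → Weights n → Fin n → Fin n → Set
ConnectedW w = Star (λ u v → 0 < w u v)

ConnectedE : ∀ {n} → EdgeSet n → Fin n → Fin n → Set
ConnectedE A = Star (λ u v → A u v ≡ true)

IsSpanningForest : ∀ {n} → Weights n → EdgeSet n → Set
IsSpanningForest w F =
    IsForest F
  × (∀ u v → F u v ≡ true → 0 < w u v)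
  × (∀ u v → ConnectedW w u v → ConnectedE F u v)

record FState (n : ℕ) : Set where
  constructor fstate
  field
    verts : VSet n
    edges : EdgeSet n
open FState public

degree : ∀ {n} → EdgeSet n → Fin n → ℕ
degree A x = sumFin λ y → if A x y then 1 else 0

removeV : ∀ {n} → VSet n → Fin n → VSet n
removeV vs x u = vs u ∧ not (u == x)

removeIncident : ∀ {n} → EdgeSet n → Fin n → EdgeSet n
removeIncident es x a b = es a b ∧ not (a == x) ∧ not (b == x)

data ContractStep {n : ℕ} (K : Fin n → Set) : FState n → FState n → Set where
  delete : ∀ {vs es} x → vs x ≡ true → ¬ K x → degree es x ≤ 1 →
           ContractStep K (fstate vs es) (fstate (removeV vs x) (removeIncident es x))
  shortcut : ∀ {vs es} x u w → vs x ≡ true → ¬ K x → degree es x ≡ 2 →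
             es x u ≡ true → es x w ≡ true → u ≢ w →
             ContractStep K (fstate vs es)
               (fstate (removeV vs x)
                  (λ a b → removeIncident es x a b
                           ∨ ((a == u ∧ b == w) ∨ (a == w ∧ b == u))))

IsContraction : ∀ {n} → (Fin n → Set) → EdgeSet n → FState n → Set
IsContraction K F R =
    Star (ContractStep K) (fstate (λ _ → true) F) R
  × (∀ R' → ¬ ContractStep K R R')

sparsifierW : ∀ {n} → Weights n → EdgeSet n → FState n → ℕ → Weights n
sparsifierW w CC R γ u v =
  if verts R u ∧ verts R v
  then (if CC u v then w u v else (if edges R u v then γ else 0))
  else 0

-- Edges of Contract(F) have weight γ > c, so a c-cut S of H never separates the two ends of one;
-- since contraction steps only delete leaves and shortcut degree-2 paths, S then extends to a
-- labelling of all vertices that is constant on the edges of F, i.e. on the components of G \ CC.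
-- Its cut-set in G therefore lies in CC, whose edges keep their multiplicity in H, so the two cuts
-- coincide. Conversely, a terminal c-cut of G may be replaced by a minimum one whose cut-set lies
-- in CC; it is then constant on F, hence on Contract(F), and in H it cuts only CC edges.
module Submission where

open import Defs
open import Level using (0ℓ)
open import Data.Nat using (ℕ; suc; _+_; _≤_; _<_; _<ᵇ_; z≤n; _<?_)
open import Data.Nat.Properties
  using (≤-reflexive; ≤-trans; ≤-antisym; <-irrefl; <⇒≱; +-mono-≤; m≤m+n; m≤n+m; n≤0⇒n≡0; ≮⇒≥;
         <-cmp; <⇒<ᵇ; +-commutativeSemigroup; module ≤-Reasoning)
open import Algebra.Properties.CommutativeSemigroup +-commutativeSemigroup using (x∙yz≈y∙xz)
open import Data.Bool using (Bool; true; false; _∧_; _∨_; not; _xor_; if_then_else_)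
open import Data.Bool.Properties
  using (∧-comm; ∨-comm; ∧-conicalˡ; ∧-conicalʳ; ∨-zeroʳ; xor-same; T-≡)
  renaming (_≟_ to _≟ᵇ_)
open import Data.Fin using (Fin; toℕ; _≟_) renaming (zero to fzero; suc to fsuc)
open import Data.Fin.Properties using (toℕ-injective; any?)
open import Data.Vec.Functional using (updateAt)
open import Data.Vec.Functional.Properties using (updateAt-updates; updateAt-minimal)
open import Data.List using (List; []; _∷_; length)
import Data.List.Relation.Unary.All as All
open All using (All; []; _∷_)
open import Data.List.Relation.Unary.AllPairs using ([]; _∷_)
open import Data.List.Relation.Unary.Unique.Propositional using (Unique)
open import Data.Product using (∃; _×_; _,_; proj₁; proj₂)
open import Data.Sum using (_⊎_; inj₁; inj₂)
open import Relation.Nullary using (¬_; yes; no; contradiction; ¬?; _×-dec_)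
open import Relation.Nullary.Decidable using (toWitness; isYes≗does; dec-true; dec-false)
open import Relation.Binary using (Rel; DecidableEquality; _Respects_; _Preserves_⟶_; Decidable)
open import Relation.Binary.Definitions using (tri<; tri≈; tri>)
open import Relation.Binary.PropositionalEquality
  using (_≡_; _≢_; refl; sym; trans; cong; cong₂; subst; subst₂)
open import Relation.Binary.Construct.Closure.ReflexiveTransitive using (Star; ε; _◅_; fold)
open import Function using (_∘_; const; _⇔_; mk⇔; Equivalence)

private
  variable
    n : ℕ
    X : Set
    a b u v x y z : Fin n

==⇒≡ : (a == b) ≡ true → a ≡ b
==⇒≡ {a = a} {b} eq = toWitness {a? = a ≟ b} (Equivalence.from T-≡ eq)

==-refl : (a == a) ≡ true
==-refl {a = a} = trans (isYes≗does (a ≟ a)) (dec-true (a ≟ a) refl)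

≢⇒==-false : a ≢ b → (a == b) ≡ false
≢⇒==-false {a = a} {b} a≢b = trans (isYes≗does (a ≟ b)) (dec-false (a ≟ b) a≢b)

∨-true : ∀ p {q} → p ∨ q ≡ true → p ≡ true ⊎ q ≡ true
∨-true true  _ = inj₁ refl
∨-true false e = inj₂ e

xor-≢ : ∀ {p q} → p ≢ q → p xor q ≡ true
xor-≢ {true}  {true}  p≢q = contradiction refl p≢q
xor-≢ {true}  {false} _   = refl
xor-≢ {false} {true}  _   = refl
xor-≢ {false} {false} p≢q = contradiction refl p≢q

true≢false : ∀ {p} → p ≡ true → p ≡ false → X
true≢false refl ()

term≤sumFin : (f : Fin n → ℕ) (i : Fin n) → f i ≤ sumFin f
term≤sumFin f fzero    = m≤m+n (f fzero) _
term≤sumFin f (fsuc i) = ≤-trans (term≤sumFin (f ∘ fsuc) i) (m≤n+m _ (f fzero))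

sumFin-mono : {f g : Fin n → ℕ} → (∀ i → f i ≤ g i) → sumFin f ≤ sumFin g
sumFin-mono {n = 0}     f≤g = z≤n
sumFin-mono {n = suc n} f≤g = +-mono-≤ (f≤g fzero) (sumFin-mono (f≤g ∘ fsuc))

sumFin-updateAt-0 : (f : Fin n → ℕ) (i : Fin n) → f i + sumFin (updateAt f i (const 0)) ≡ sumFin f
sumFin-updateAt-0 f fzero    = refl
sumFin-updateAt-0 f (fsuc i) =
  trans (x∙yz≈y∙xz (f (fsuc i)) (f fzero) _) (cong (f fzero +_) (sumFin-updateAt-0 (f ∘ fsuc) i))

length≤sumFin : (f : Fin n → ℕ) {is : List (Fin n)} → Unique is → All (λ i → 1 ≤ f i) is →
                length is ≤ sumFin f
length≤sumFin f {[]}     []                   []            = z≤n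
length≤sumFin f {i ∷ is} (i∉is ∷ is-unique) (fi>0 ∷ fis>0) = begin
  1 + length is    ≤⟨ +-mono-≤ fi>0 (length≤sumFin f′ is-unique (All.zipWith kept (i∉is , fis>0))) ⟩
  f i + sumFin f′  ≡⟨ sumFin-updateAt-0 f i ⟩
  sumFin f         ∎
  where
  open ≤-Reasoning
  f′ : Fin _ → ℕ
  f′ = updateAt f i (const 0)
  kept : ∀ {j} → i ≢ j × 1 ≤ f j → 1 ≤ f′ j
  kept (i≢j , fj>0) = subst (1 ≤_) (sym (updateAt-minimal _ i f (i≢j ∘ sym))) fj>0

Adj : EdgeSet n → Rel (Fin n) 0ℓ
Adj A a b = A a b ≡ true

neighbours≤degree : (A : EdgeSet n) {ys : List (Fin n)} → Unique ys → All (Adj A x) ys →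
                    length ys ≤ degree A x
neighbours≤degree {x = x} A uniq adj = length≤sumFin _ uniq (All.map counted adj)
  where
  counted : Adj A x y → 1 ≤ (if A x y then 1 else 0)
  counted e rewrite e = ≤-reflexive refl

degree≤1⇒unique-neighbour : (A : EdgeSet n) → degree A x ≤ 1 → Adj A x y → Adj A x z → y ≡ z
degree≤1⇒unique-neighbour {y = y} {z} A deg xy xz with y ≟ z
... | yes y≡z = y≡z
... | no  y≢z = contradiction (≤-trans (neighbours≤degree A ((y≢z ∷ []) ∷ [] ∷ []) (xy ∷ xz ∷ [])) deg)
                              (<-irrefl refl)

degree≡2⇒neighbour-cases : (A : EdgeSet n) → degree A x ≡ 2 → Adj A x u → Adj A x v → u ≢ v →
                           Adj A x y → y ≡ u ⊎ y ≡ v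
degree≡2⇒neighbour-cases {u = u} {v} {y} A deg xu xv u≢v xy with y ≟ u | y ≟ v
... | yes y≡u | _       = inj₁ y≡u
... | no  _   | yes y≡v = inj₂ y≡v
... | no  y≢u | no  y≢v =
  contradiction (subst (3 ≤_) deg (neighbours≤degree A unique (xu ∷ xv ∷ xy ∷ []))) (<-irrefl refl)
  where
  unique : Unique (u ∷ v ∷ y ∷ [])
  unique = (u≢v ∷ (y≢u ∘ sym) ∷ []) ∷ ((y≢v ∘ sym) ∷ []) ∷ [] ∷ []

crossing : Weights n → (Fin n → Bool) → Fin n → Fin n → ℕ
crossing w S a b = if S a xor S b then w a b else 0

crossing-≢ : (w : Weights n) (S : Fin n → Bool) → S a ≢ S b → crossing w S a b ≡ w a b
crossing-≢ w S Sa≢Sb = cong (λ t → if t then _ else 0) (xor-≢ Sa≢Sb)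

crossing-¬InCutSet : (w : Weights n) (S : Fin n → Bool) → ¬ InCutSet w S a b → crossing w S a b ≡ 0
crossing-¬InCutSet {a = a} {b} w S ¬cut with S a ≟ᵇ S b
... | yes Sa≡Sb = cong (λ t → if t then _ else 0) (trans (cong (_xor S b) Sa≡Sb) (xor-same (S b)))
... | no  Sa≢Sb = trans (crossing-≢ w S Sa≢Sb) (n≤0⇒n≡0 (≮⇒≥ λ w>0 → ¬cut (w>0 , Sa≢Sb)))

InCutSet? : (w : Weights n) (S : Fin n → Bool) → Decidable (InCutSet w S)
InCutSet? w S a b = (0 <? w a b) ×-dec ¬? (S a ≟ᵇ S b)

cutSize-mono : ∀ {w₁ w₂ : Weights n} {S₁ S₂} →
               (∀ a b → crossing w₁ S₁ a b ≤ crossing w₂ S₂ a b) → cutSize w₁ S₁ ≤ cutSize w₂ S₂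
cutSize-mono le = sumFin-mono λ a → sumFin-mono λ b → ordered (toℕ a <ᵇ toℕ b) (le a b)
  where
  ordered : ∀ o {p q m m′} → (if p then m else 0) ≤ (if q then m′ else 0) →
            (if o ∧ p then m else 0) ≤ (if o ∧ q then m′ else 0)
  ordered true  le = le
  ordered false _  = z≤n

cutSize-cong : ∀ {w₁ w₂ : Weights n} {S₁ S₂} →
               (∀ a b → crossing w₁ S₁ a b ≡ crossing w₂ S₂ a b) → cutSize w₁ S₁ ≡ cutSize w₂ S₂
cutSize-cong {w₁ = w₁} {w₂} {S₁} {S₂} eq =
  ≤-antisym (cutSize-mono {w₁ = w₁} {w₂} {S₁} {S₂} (λ a b → ≤-reflexive (eq a b)))
            (cutSize-mono {w₁ = w₂} {w₁} {S₂} {S₁} (λ a b → ≤-reflexive (sym (eq a b))))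

cutSize-mono-InCutSet : ∀ {w₁ w₂ : Weights n} {S} →
                        (∀ {a b} → InCutSet w₁ S a b → w₁ a b ≤ w₂ a b) → cutSize w₁ S ≤ cutSize w₂ S
cutSize-mono-InCutSet {w₁ = w₁} {w₂} {S} le = cutSize-mono {w₁ = w₁} {w₂} {S} {S} term
  where
  term : ∀ a b → crossing w₁ S a b ≤ crossing w₂ S a b
  term a b with InCutSet? w₁ S a b
  ... | yes cut@(_ , Sa≢Sb) =
    subst₂ _≤_ (sym (crossing-≢ w₁ S Sa≢Sb)) (sym (crossing-≢ w₂ S Sa≢Sb)) (le cut)
  ... | no ¬cut = subst (_≤ _) (sym (crossing-¬InCutSet w₁ S ¬cut)) z≤n

cutSize-cong-InCutSet : ∀ {w₁ w₂ : Weights n} {S₁ S₂} →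
                        (∀ a b → InCutSet w₁ S₁ a b ⇔ InCutSet w₂ S₂ a b) →
                        (∀ a b → InCutSet w₂ S₂ a b → w₁ a b ≡ w₂ a b) →
                        cutSize w₁ S₁ ≡ cutSize w₂ S₂
cutSize-cong-InCutSet {w₁ = w₁} {w₂} {S₁} {S₂} same-cut same-weight =
  cutSize-cong {w₁ = w₁} {w₂} {S₁} {S₂} term
  where
  term : ∀ a b → crossing w₁ S₁ a b ≡ crossing w₂ S₂ a b
  term a b with InCutSet? w₂ S₂ a b
  ... | yes cut₂@(_ , S₂a≢S₂b) =
    trans (crossing-≢ w₁ S₁ (proj₂ (Equivalence.from (same-cut a b) cut₂)))
          (trans (same-weight a b cut₂) (sym (crossing-≢ w₂ S₂ S₂a≢S₂b)))
  ... | no ¬cut₂ =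
    trans (crossing-¬InCutSet w₁ S₁ (¬cut₂ ∘ Equivalence.to (same-cut a b)))
          (sym (crossing-¬InCutSet w₂ S₂ ¬cut₂))

ordered-weight≤cutSize : ∀ {w : Weights n} {S} → toℕ a < toℕ b → S a ≢ S b → w a b ≤ cutSize w S
ordered-weight≤cutSize {a = a} {b} {w} {S} a<b Sa≢Sb =
  ≤-trans (≤-reflexive (sym summand)) (≤-trans (term≤sumFin _ b) (term≤sumFin _ a))
  where
  summand : (if (toℕ a <ᵇ toℕ b) ∧ (S a xor S b) then w a b else 0) ≡ w a b
  summand rewrite Equivalence.to T-≡ (<⇒<ᵇ a<b) | xor-≢ Sa≢Sb = refl

weight≤cutSize : ∀ {w : Weights n} {S} → w a b ≡ w b a → S a ≢ S b → w a b ≤ cutSize w S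
weight≤cutSize {a = a} {b} {w} {S} wab≡wba Sa≢Sb with <-cmp (toℕ a) (toℕ b)
... | tri< a<b _ _ = ordered-weight≤cutSize a<b Sa≢Sb
... | tri≈ _ a≡b _ = contradiction (cong S (toℕ-injective a≡b)) Sa≢Sb
... | tri> _ _ b<a = subst (_≤ cutSize w S) (sym wab≡wba) (ordered-weight≤cutSize b<a (Sa≢Sb ∘ sym))

IsCutOn⇒IsCut : ∀ {VS : VSet n} {S S′ : Fin n → Bool} →
                IsCutOn VS S → (∀ {v} → VS v ≡ true → S′ v ≡ S v) → IsCut S′
IsCutOn⇒IsCut ((u , u∈ , Su) , (v , v∈ , Sv)) S′≈S =
  (u , refl , trans (S′≈S u∈) Su) , (v , refl , trans (S′≈S v∈) Sv)

terminal-cut-IsCutOn : ∀ {T T′ VS : VSet n} {S} → (∀ {t} → T t ≡ true → VS t ≡ true) →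
                       IsBipartitionOf T T′ → PartitionsT S T T′ → IsCutOn VS S
terminal-cut-IsCutOn T⊆VS (T′⊆T , (t₁ , t₁∈T′) , (t₂ , t₂∈T , t₂∉T′)) (inj₁ S≈T′) =
    (t₁ , T⊆VS (T′⊆T t₁ t₁∈T′) , trans (S≈T′ t₁ (T′⊆T t₁ t₁∈T′)) t₁∈T′)
  , (t₂ , T⊆VS t₂∈T , trans (S≈T′ t₂ t₂∈T) t₂∉T′)
terminal-cut-IsCutOn T⊆VS (T′⊆T , (t₁ , t₁∈T′) , (t₂ , t₂∈T , t₂∉T′)) (inj₂ S≈¬T′) =
    (t₂ , T⊆VS t₂∈T , trans (S≈¬T′ t₂ t₂∈T) (cong not t₂∉T′))
  , (t₁ , T⊆VS (T′⊆T t₁ t₁∈T′) , trans (S≈¬T′ t₁ (T′⊆T t₁ t₁∈T′)) (cong not t₁∈T′))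

constant-on-paths : ∀ {A : EdgeSet n} (g : Fin n → X) →
                    g Preserves Adj A ⟶ _≡_ → g Preserves Star (Adj A) ⟶ _≡_
constant-on-paths g g-const = fold (λ a b → g a ≡ g b) (λ e → trans (g-const e)) refl

Respects-Star : ∀ {a ℓ p} {A : Set a} {T : Rel A ℓ} {P : A → Set p} → P Respects T → P Respects Star T
Respects-Star resp ε         = λ p → p
Respects-Star resp (t ◅ ts) = Respects-Star resp ts ∘ resp t

record WellFormed (K : Fin n → Set) (s : FState n) : Set where
  field
    edges-sym    : ∀ a b → edges s a b ≡ edges s b a
    edges-irrefl : ∀ a → edges s a a ≡ false
    edges⊆verts  : Adj (edges s) a b → verts s a ≡ true
    K⊆verts      : K v → verts s v ≡ true

  adj-sym : Adj (edges s) a b → Adj (edges s) b a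
  adj-sym {a} {b} e = trans (edges-sym b a) e

open WellFormed

not-==⇒≢ : not (a == b) ≡ true → a ≢ b
not-==⇒≢ ¬a=b refl = true≢false ==-refl (not-true ¬a=b)
  where
  not-true : ∀ {p} → not p ≡ true → p ≡ false
  not-true {false} _ = refl

removeV⁺ : (vs : VSet n) → vs v ≡ true → v ≢ x → removeV vs x v ≡ true
removeV⁺ vs v∈vs v≢x rewrite v∈vs | ≢⇒==-false v≢x = refl

removeV⁻ : (vs : VSet n) → removeV vs x v ≡ true → vs v ≡ true × v ≢ x
removeV⁻ {v = v} vs e = ∧-conicalˡ (vs v) _ e , not-==⇒≢ (∧-conicalʳ _ _ e)

removeIncident⁺ : (es : EdgeSet n) → Adj es a b → a ≢ x → b ≢ x → Adj (removeIncident es x) a b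
removeIncident⁺ es ab a≢x b≢x rewrite ab | ≢⇒==-false a≢x | ≢⇒==-false b≢x = refl

removeIncident⁻ : (es : EdgeSet n) → Adj (removeIncident es x) a b → Adj es a b × a ≢ x × b ≢ x
removeIncident⁻ {x = x} {a = a} {b} es e =
  ∧-conicalˡ (es a b) _ e , not-==⇒≢ (∧-conicalˡ _ _ ends) , not-==⇒≢ (∧-conicalʳ _ _ ends)
  where
  ends : not (a == x) ∧ not (b == x) ≡ true
  ends = ∧-conicalʳ (es a b) _ e

link : Fin n → Fin n → EdgeSet n
link u v a b = (a == u ∧ b == v) ∨ (a == v ∧ b == u)

link-sym : ∀ (u v a b : Fin n) → link u v a b ≡ link u v b a
link-sym u v a b =
  trans (∨-comm (a == u ∧ b == v) _) (cong₂ _∨_ (∧-comm (a == v) (b == u)) (∧-comm (a == u) (b == v)))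

link-irrefl : u ≢ v → ∀ a → link u v a a ≡ false
link-irrefl {u = u} {v} u≢v a with a ≟ u | a ≟ v
... | yes refl | yes refl = contradiction refl u≢v
... | yes _    | no  _    = refl
... | no  _    | yes _    = refl
... | no  _    | no  _    = refl

link-joins : ∀ (u v : Fin n) → Adj (link u v) u v
link-joins u v rewrite ==-refl {a = u} | ==-refl {a = v} = refl

link-ends : Adj (link u v) a b → (a ≡ u × b ≡ v) ⊎ (a ≡ v × b ≡ u)
link-ends {u = u} {v} {a} {b} e with ∨-true (a == u ∧ b == v) e
... | inj₁ e′ = inj₁ (==⇒≡ (∧-conicalˡ _ _ e′) , ==⇒≡ (∧-conicalʳ _ _ e′))
... | inj₂ e′ = inj₂ (==⇒≡ (∧-conicalˡ _ _ e′) , ==⇒≡ (∧-conicalʳ _ _ e′))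

shortcutEdges : EdgeSet n → Fin n → Fin n → Fin n → EdgeSet n
shortcutEdges es x u v a b = removeIncident es x a b ∨ link u v a b

ConstantExtension : VSet n → EdgeSet n → (Fin n → X) → Set
ConstantExtension vs es S = ∃ λ S₀ → S₀ Preserves Adj es ⟶ _≡_ × (∀ {v} → vs v ≡ true → S₀ v ≡ S v)

module _ {K : Fin n → Set} {vs es} (wf : WellFormed K (fstate vs es)) {x : Fin n} (x∉K : ¬ K x) where

  neighbour-survives : Adj es x y → removeV vs x y ≡ true
  neighbour-survives {y} xy =
    removeV⁺ vs (edges⊆verts wf (adj-sym wf xy)) λ { refl → true≢false xy (edges-irrefl wf x) }

  removeIncident-wf : WellFormed K (fstate (removeV vs x) (removeIncident es x))
  removeIncident-wf = record
    { edges-sym    = λ a b → cong₂ _∧_ (edges-sym wf a b) (∧-comm (not (a == x)) (not (b == x)))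
    ; edges-irrefl = λ a → cong (_∧ _) (edges-irrefl wf a)
    ; edges⊆verts  = λ e → let ab , a≢x , _ = removeIncident⁻ es e
                           in removeV⁺ vs (edges⊆verts wf ab) a≢x
    ; K⊆verts      = λ k → removeV⁺ vs (K⊆verts wf k) λ { refl → x∉K k }
    }

  shortcut-wf : Adj es x u → Adj es x v → u ≢ v →
                WellFormed K (fstate (removeV vs x) (shortcutEdges es x u v))
  shortcut-wf {u} {v} xu xv u≢v = record
    { edges-sym    = λ a b → cong₂ _∨_ (edges-sym removeIncident-wf a b) (link-sym u v a b)
    ; edges-irrefl = λ a → cong₂ _∨_ (edges-irrefl removeIncident-wf a) (link-irrefl u≢v a)
    ; edges⊆verts  = ends-survive
    ; K⊆verts      = K⊆verts removeIncident-wf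
    }
    where
    ends-survive : Adj (shortcutEdges es x u v) a b → removeV vs x a ≡ true
    ends-survive {a} {b} e with ∨-true (removeIncident es x a b) e
    ... | inj₁ old = edges⊆verts removeIncident-wf old
    ... | inj₂ new with link-ends {u = u} {v} {a} {b} new
    ...   | inj₁ (refl , _) = neighbour-survives xu
    ...   | inj₂ (refl , _) = neighbour-survives xv

  relabel : (S : Fin n → X) → S Preserves Adj (removeIncident es x) ⟶ _≡_ →
            (∃ λ val → ∀ {y} → Adj es x y → val ≡ S y) → ConstantExtension (removeV vs x) es S
  relabel S S-const (val , val≡neighbours) =
    updateAt S x (const val) , constant , λ {v} v∈ → updateAt-minimal v x S (proj₂ (removeV⁻ vs v∈))
    where
    constant : updateAt S x (const val) Preserves Adj es ⟶ _≡_
    constant {a} {b} e with a ≟ x | b ≟ x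
    ... | yes refl | yes refl = refl
    ... | yes refl | no  b≢x  =
      trans (updateAt-updates x S) (trans (val≡neighbours e) (sym (updateAt-minimal b x S b≢x)))
    ... | no  a≢x  | yes refl =
      trans (updateAt-minimal a x S a≢x)
            (trans (sym (val≡neighbours (adj-sym wf e))) (sym (updateAt-updates x S)))
    ... | no  a≢x  | no  b≢x  =
      trans (updateAt-minimal a x S a≢x)
            (trans (S-const (removeIncident⁺ es e a≢x b≢x)) (sym (updateAt-minimal b x S b≢x)))

degree≤1⇒uniform-neighbours : (A : EdgeSet n) → degree A x ≤ 1 → (S : Fin n → X) →
                              ∃ λ val → ∀ {y} → Adj A x y → val ≡ S y
degree≤1⇒uniform-neighbours {x = x} A deg S with any? (λ y → A x y ≟ᵇ true)
... | yes (y , xy) = S y , λ xz → cong S (degree≤1⇒unique-neighbour A deg xy xz)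
... | no  isolated = S x , λ xy → contradiction (_ , xy) isolated

step-wf : {K : Fin n → Set} → WellFormed K Respects ContractStep K
step-wf (delete x _ x∉K _)                  wf = removeIncident-wf wf x∉K
step-wf (shortcut x u v _ x∉K _ xu xv u≢v) wf = shortcut-wf wf x∉K xu xv u≢v

step-preserves-constant : {K : Fin n → Set} (g : Fin n → X) →
                          (λ s → g Preserves Adj (edges s) ⟶ _≡_) Respects ContractStep K
step-preserves-constant g (delete {es = es} x _ _ _) g-const e = g-const (proj₁ (removeIncident⁻ es e))
step-preserves-constant g (shortcut {es = es} x u v _ _ _ xu xv _) g-const {a} {b} e
  with ∨-true (removeIncident es x a b) e
... | inj₁ old = g-const (proj₁ (removeIncident⁻ es old))
... | inj₂ new with link-ends {u = u} {v} {a} {b} new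
...   | inj₁ (refl , refl) = trans (sym (g-const xu)) (g-const xv)
...   | inj₂ (refl , refl) = trans (sym (g-const xv)) (g-const xu)

step-reflects-constant : ∀ {K : Fin n → Set} {s t} → ContractStep K s t → WellFormed K s →
                         (S : Fin n → X) → S Preserves Adj (edges t) ⟶ _≡_ →
                         ConstantExtension (verts t) (edges s) S
step-reflects-constant (delete {es = es} x _ x∉K deg) wf S S-const =
  relabel wf x∉K S S-const (degree≤1⇒uniform-neighbours es deg S)
step-reflects-constant (shortcut {es = es} x u v _ x∉K deg xu xv u≢v) wf S S-const =
  relabel wf x∉K S (S-const ∘ cong (_∨ _)) (S u , val≡neighbours)
  where
  Su≡Sv : S u ≡ S v
  Su≡Sv = S-const (trans (cong (removeIncident es x u v ∨_) (link-joins u v)) (∨-zeroʳ _))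
  val≡neighbours : Adj es x y → S u ≡ S y
  val≡neighbours xy with degree≡2⇒neighbour-cases es deg xu xv u≢v xy
  ... | inj₁ refl = refl
  ... | inj₂ refl = Su≡Sv

contraction-verts⊆ : ∀ {K : Fin n → Set} {s t} → Star (ContractStep K) s t →
                     verts t v ≡ true → verts s v ≡ true
contraction-verts⊆ ε                                      = λ v∈t → v∈t
contraction-verts⊆ (delete {vs} _ _ _ _ ◅ ts)             = proj₁ ∘ removeV⁻ vs ∘ contraction-verts⊆ ts
contraction-verts⊆ (shortcut {vs} _ _ _ _ _ _ _ _ _ ◅ ts) = proj₁ ∘ removeV⁻ vs ∘ contraction-verts⊆ ts

contraction-reflects-constant : ∀ {K : Fin n → Set} {s t} → Star (ContractStep K) s t → WellFormed K s →
                                (S : Fin n → X) → S Preserves Adj (edges t) ⟶ _≡_ →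
                                ConstantExtension (verts t) (edges s) S
contraction-reflects-constant ε wf S S-const = S , S-const , λ _ → refl
contraction-reflects-constant (t ◅ ts) wf S S-const
  with contraction-reflects-constant ts (step-wf t wf) S S-const
... | S₁ , S₁-const , S₁≈S with step-reflects-constant t wf S₁ S₁-const
...   | S₀ , S₀-const , S₀≈S₁ = S₀ , S₀-const , λ v∈ → trans (S₀≈S₁ (contraction-verts⊆ ts v∈)) (S₁≈S v∈)

sparsifierW-CC : ∀ (w : Weights n) CC R γ → verts R a ≡ true → verts R b ≡ true → CC a b ≡ true →
                 sparsifierW w CC R γ a b ≡ w a b
sparsifierW-CC w CC R γ a∈R b∈R ab∈CC rewrite a∈R | b∈R | ab∈CC = refl

sparsifierW-forest : ∀ (w : Weights n) CC R γ → verts R a ≡ true → verts R b ≡ true → CC a b ≡ false →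
                     Adj (edges R) a b → sparsifierW w CC R γ a b ≡ γ
sparsifierW-forest w CC R γ a∈R b∈R ab∉CC ab∈R rewrite a∈R | b∈R | ab∉CC | ab∈R = refl

sparsifierW-pos : ∀ (w : Weights n) CC R γ → 0 < sparsifierW w CC R γ a b →
                  CC a b ≡ true ⊎ Adj (edges R) a b
sparsifierW-pos {a = a} {b} w CC R γ = cases (verts R a ∧ verts R b) (CC a b) (edges R a b)
  where
  cases : ∀ p q r {m k} → 0 < (if p then (if q then m else (if r then k else 0)) else 0) →
          q ≡ true ⊎ r ≡ true
  cases true true  _    _ = inj₁ refl
  cases true false true _ = inj₂ refl

Kept : VSet n → EdgeSet n → Fin n → Set
Kept T CC x = T x ≡ true ⊎ InEnd CC x

module Sparsifier (G : Multigraph n) (T : VSet n) (CC : EdgeSet n)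
                  (CC-intercluster : IsInterclusterSet (Multigraph.w G) CC)
                  (F : EdgeSet n) (F-spanning : IsSpanningForest (removeEdges (Multigraph.w G) CC) F)
                  (γ : ℕ) (R : FState n)
                  (F↝R : Star (ContractStep (Kept T CC)) (fstate (λ _ → true) F) R) where

  private
    w wH : Weights n
    w  = Multigraph.w G
    wH = sparsifierW w CC R γ

    F-wf : WellFormed (Kept T CC) (fstate (λ _ → true) F)
    F-wf = record
      { edges-sym    = proj₁ (proj₁ F-spanning)
      ; edges-irrefl = proj₁ (proj₂ (proj₁ F-spanning))
      ; edges⊆verts  = λ _ → refl
      ; K⊆verts      = λ _ → refl
      }

    R-wf : WellFormed (Kept T CC) R
    R-wf = Respects-Star step-wf F↝R F-wf

    F-edge : Adj F a b → CC a b ≡ false × 0 < w a b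
    F-edge {a} {b} e = outside-CC (CC a b) (proj₁ (proj₂ F-spanning) a b e)
      where
      outside-CC : ∀ p {m} → 0 < (if p then 0 else m) → p ≡ false × 0 < m
      outside-CC false m>0 = refl , m>0

  cut⊆CC⇒constant-on-F : DecidableEquality X → (g : Fin n → X) →
                         (∀ {a b} → 0 < w a b → g a ≢ g b → CC a b ≡ true) → g Preserves Adj F ⟶ _≡_
  cut⊆CC⇒constant-on-F _≟ₓ_ g cut⊆CC {a} {b} e with g a ≟ₓ g b
  ... | yes ga≡gb = ga≡gb
  ... | no  ga≢gb = true≢false (cut⊆CC (proj₂ (F-edge e)) ga≢gb) (proj₁ (F-edge e))

  constant-on-F⇒cut⊆CC : (g : Fin n → X) → g Preserves Adj F ⟶ _≡_ →
                         0 < w a b → g a ≢ g b → CC a b ≡ true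
  constant-on-F⇒cut⊆CC {a = a} {b} g g-const w>0 ga≢gb with CC a b in ab∈CC
  ... | true  = refl
  ... | false =
    contradiction (constant-on-paths g g-const (proj₂ (proj₂ F-spanning) a b (outside ◅ ε))) ga≢gb
    where
    outside : 0 < removeEdges w CC a b
    outside = subst (λ p → 0 < (if p then 0 else w a b)) (sym ab∈CC) w>0

  private
    p : Fin n → Fin n
    p = proj₁ CC-intercluster

    CC⇔ : ∀ a b → (CC a b ≡ true) ⇔ (0 < w a b × p a ≢ p b)
    CC⇔ = proj₂ CC-intercluster

    p-constant-on-R : p Preserves Adj (edges R) ⟶ _≡_
    p-constant-on-R = Respects-Star (step-preserves-constant p) F↝R
      (cut⊆CC⇒constant-on-F _≟_ p λ w>0 pa≢pb → Equivalence.from (CC⇔ _ _) (w>0 , pa≢pb))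

    -- A shortcut edge of Contract(F) could a priori join the ends of a CC edge; p, constant along F, rules this out.
    R-edge∉CC : Adj (edges R) a b → CC a b ≡ false
    R-edge∉CC {a} {b} e with CC a b in ab∈CC
    ... | false = refl
    ... | true  = contradiction (p-constant-on-R e) (proj₂ (Equivalence.to (CC⇔ a b) ab∈CC))

    CC-sym : CC a b ≡ true → CC b a ≡ true
    CC-sym {a} {b} ab∈CC =
      let w>0 , pa≢pb = Equivalence.to (CC⇔ a b) ab∈CC
      in Equivalence.from (CC⇔ b a) (subst (0 <_) (Multigraph.symm G a b) w>0 , pa≢pb ∘ sym)

    CC⊆R : CC a b ≡ true → verts R a ≡ true
    CC⊆R ab∈CC = K⊆verts R-wf (inj₂ (_ , ab∈CC))

    wH-CC : CC a b ≡ true → wH a b ≡ w a b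
    wH-CC ab∈CC = sparsifierW-CC w CC R γ (CC⊆R ab∈CC) (CC⊆R (CC-sym ab∈CC)) ab∈CC

    wH-R : Adj (edges R) a b → wH a b ≡ γ
    wH-R e = sparsifierW-forest w CC R γ (edges⊆verts R-wf e) (edges⊆verts R-wf (adj-sym R-wf e))
                                (R-edge∉CC e) e

    H-cut⊆CC : ∀ {S} → S Preserves Adj (edges R) ⟶ _≡_ → InCutSet wH S a b → CC a b ≡ true
    H-cut⊆CC {a = a} {b} S-const (wH>0 , Sa≢Sb) with sparsifierW-pos w CC R γ wH>0
    ... | inj₁ ab∈CC = ab∈CC
    ... | inj₂ ab∈R  = contradiction (S-const ab∈R) Sa≢Sb

  light-cut-constant-on-R : ∀ {c S} → c < γ → cutSize wH S ≤ c → S Preserves Adj (edges R) ⟶ _≡_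
  light-cut-constant-on-R {c} {S} c<γ small {a} {b} e with S a ≟ᵇ S b
  ... | yes Sa≡Sb = Sa≡Sb
  ... | no  Sa≢Sb = contradiction γ≤c (<⇒≱ c<γ)
    where
    open ≤-Reasoning
    γ≤c : γ ≤ c
    γ≤c = begin
      γ              ≡⟨ sym (wH-R e) ⟩
      wH a b         ≤⟨ weight≤cutSize {w = wH} {S} (trans (wH-R e) (sym (wH-R (adj-sym R-wf e)))) Sa≢Sb ⟩
      cutSize wH S   ≤⟨ small ⟩
      c              ∎

  c-cut-lifts : ∀ {c} → c < γ → ∀ S → IsCutOn (verts R) S → cutSize wH S ≤ c →
                ∃ λ S′ → IsCut S′
                  × (∀ u v → InCutSet w S′ u v ⇔ InCutSet wH S u v)
                  × (∀ u v → InCutSet wH S u v → w u v ≡ wH u v)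
                  × cutSize w S′ ≡ cutSize wH S
  c-cut-lifts c<γ S S-cut small
    with contraction-reflects-constant F↝R F-wf S (light-cut-constant-on-R {S = S} c<γ small)
  ... | S′ , S′-const , S′≈S =
    S′ , IsCutOn⇒IsCut {S = S} S-cut S′≈S , same-cut , weights
       , cutSize-cong-InCutSet {w₁ = w} {wH} {S′} {S} same-cut weights
    where
    sides : CC a b ≡ true → (S′ a ≡ S′ b) ⇔ (S a ≡ S b)
    sides ab∈CC = mk⇔ (λ eq → trans (sym (S′≈S (CC⊆R ab∈CC))) (trans eq (S′≈S (CC⊆R (CC-sym ab∈CC)))))
                      (λ eq → trans (S′≈S (CC⊆R ab∈CC)) (trans eq (sym (S′≈S (CC⊆R (CC-sym ab∈CC))))))
    H-cut⊆CC′ : InCutSet wH S a b → CC a b ≡ true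
    H-cut⊆CC′ = H-cut⊆CC {S = S} (light-cut-constant-on-R {S = S} c<γ small)
    same-cut : ∀ a b → InCutSet w S′ a b ⇔ InCutSet wH S a b
    same-cut a b = mk⇔
      (λ (w>0 , S′a≢S′b) → let ab∈CC = constant-on-F⇒cut⊆CC S′ S′-const w>0 S′a≢S′b in
         subst (0 <_) (sym (wH-CC ab∈CC)) w>0 , S′a≢S′b ∘ Equivalence.from (sides ab∈CC))
      (λ cut@(wH>0 , Sa≢Sb) → let ab∈CC = H-cut⊆CC′ cut in
         subst (0 <_) (wH-CC ab∈CC) wH>0 , Sa≢Sb ∘ Equivalence.to (sides ab∈CC))
    weights : ∀ a b → InCutSet wH S a b → w a b ≡ wH a b
    weights a b cut = sym (wH-CC (H-cut⊆CC′ cut))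

  terminal-cut-descends : ∀ {c} → IsCutContainmentSet w T c CC →
    ∀ T′ → IsBipartitionOf T T′ → ∀ S → IsCut S → cutSize w S ≤ c → PartitionsT S T T′ →
    ∃ λ S′ → IsCutOn (verts R) S′ × cutSize wH S′ ≤ cutSize w S × PartitionsT S′ T T′
  terminal-cut-descends (_ , contains-min-cut) T′ T′-bip S S-cut small S-part
    with contains-min-cut T′ T′-bip (S , S-cut , small , S-part)
  ... | S₀ , ((_ , _ , S₀-part) , S₀-min) , S₀-cut⊆CC =
    S₀ , terminal-cut-IsCutOn (K⊆verts R-wf ∘ inj₁) T′-bip S₀-part , S₀-lighter , S₀-part
    where
    S₀-constant-on-R : S₀ Preserves Adj (edges R) ⟶ _≡_
    S₀-constant-on-R = Respects-Star (step-preserves-constant S₀) F↝R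
      (cut⊆CC⇒constant-on-F _≟ᵇ_ S₀ λ w>0 S₀a≢S₀b → S₀-cut⊆CC _ _ (w>0 , S₀a≢S₀b))
    open ≤-Reasoning
    S₀-lighter : cutSize wH S₀ ≤ cutSize w S
    S₀-lighter = begin
      cutSize wH S₀  ≤⟨ cutSize-mono-InCutSet {w₁ = wH} {w} {S₀}
                          (≤-reflexive ∘ wH-CC ∘ H-cut⊆CC {S = S₀} S₀-constant-on-R) ⟩
      cutSize w S₀   ≤⟨ S₀-min S (S-cut , small , S-part) ⟩
      cutSize w S    ∎

lemma4p1 : ∀ {n} (G : Multigraph n) (T : VSet n) (c : ℕ) → 1 ≤ c →
    (CC : EdgeSet n) → IsCutContainmentSet (Multigraph.w G) T c CC →
    (F : EdgeSet n) → IsSpanningForest (removeEdges (Multigraph.w G) CC) F →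
    (γ : ℕ) → c < γ →
    (R : FState n) →
    IsContraction (λ x → T x ≡ true ⊎ InEnd CC x) F R →
    let w  = Multigraph.w G
        wH = sparsifierW w CC R γ
    in
    -- (1) every c-cut of H has the cut-set (and size) of some cut of G
    (∀ (S : Fin n → Bool) → IsCutOn (verts R) S → cutSize wH S ≤ c →
       ∃ λ (S' : Fin n → Bool) → IsCut S'
         × (∀ u v → InCutSet w S' u v ⇔ InCutSet wH S u v)
         × (∀ u v → InCutSet wH S u v → w u v ≡ wH u v)
         × cutSize w S' ≡ cutSize wH S)
    ×
    -- (2) terminal c-cuts of G are matched by no-larger cuts of H
    (∀ (T' : VSet n) → IsBipartitionOf T T' →
       ∀ (S : Fin n → Bool) → IsCut S → cutSize w S ≤ c → PartitionsT S T T' →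
       ∃ λ (S' : Fin n → Bool) → IsCutOn (verts R) S'
         × cutSize wH S' ≤ cutSize w S
         × PartitionsT S' T T')
lemma4p1 G T c _ CC CC-contains F F-spanning γ c<γ R (F↝R , _) =
  c-cut-lifts c<γ , terminal-cut-descends CC-contains
  where open Sparsifier G T CC (proj₁ CC-contains) F F-spanning γ R F↝R
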